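{- Let $G$ be a strongly connected graph with $N$ nodes and girth $g$. For every node $i$, the set $\mathbf{N}_{i,i}=\{n\in\mathbb{N}^*: \text{there is a closed walk of length } n \text{ starting at } i\}$ has a subset $\mathbf{A}$ with $\gcd(\mathbf{A})=\gcd(\mathbf{N}_{i,i})$ such that $\mathbf{A}$ contains the lengths of all nonempty cycles starting at $i$ and every $n\in\mathbf{A}$ satisfies $g\le n\le 2N-1$.
   Context: Graphs are finite directed graphs. A walk is a finite sequence of consecutive edges; a cycle is a closed walk containing no nonempty closed walk as a proper subwalk. The girth $g$ is the minimal length of a nonempty cycle (so $G$ is assumed to contain a nonempty cycle). -}

module Defs where

open import Data.Nat using (ℕ; zero; suc; _≤_; _<_)
open import Data.Nat.Divisibility using (_∣_)
open import Data.Fin using (Fin; toℕ; inject₁; fromℕ)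
open import Data.Bool using (Bool; T)
open import Data.Product using (Σ; _×_; ∃)
open import Relation.Binary.PropositionalEquality using (_≡_)
open import Relation.Unary using (Pred)
open import Level using (0ℓ)

-- A finite directed graph on the node set Fin N, given by its adjacency
-- relation (multiple parallel edges are irrelevant for walk lengths).
Graph : ℕ → Set
Graph N = Fin N → Fin N → Bool

Edge : ∀ {N} → Graph N → Fin N → Fin N → Set
Edge G i j = T (G i j)

record Walk {N : ℕ} (G : Graph N) (n : ℕ) : Set where
  field
    vtx  : Fin (suc n) → Fin N
    step : (k : Fin n) → Edge G (vtx (inject₁ k)) (vtx (Fin.suc k))

  start : Fin N
  start = vtx Fin.zero

  end : Fin N
  end = vtx (fromℕ n)

open Walk public

IsClosed : ∀ {N n} {G : Graph N} → Walk G n → Set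
IsClosed w = start w ≡ end w

-- A cycle: a closed walk containing no nonempty closed walk as a proper
-- subwalk.  The subwalk between positions a ≤ b is the segment v_a … v_b;
-- it is nonempty iff a < b, closed iff v_a = v_b, and proper iff
-- (a , b) ≠ (0 , n).
IsCycle : ∀ {N n} {G : Graph N} → Walk G n → Set
IsCycle {n = n} w =
  IsClosed w ×
  (∀ (a b : Fin (suc n)) → toℕ a < toℕ b → vtx w a ≡ vtx w b →
     (toℕ a ≡ 0 × toℕ b ≡ n))

StronglyConnected : ∀ {N} → Graph N → Set
StronglyConnected {N} G =
  ∀ (i j : Fin N) → Σ ℕ λ n → Σ (Walk G n) λ w → start w ≡ i × end w ≡ j

IsGirth : ∀ {N} → Graph N → ℕ → Set
IsGirth G g =
  (Σ ℕ λ n → Σ (Walk G n) λ w → 1 ≤ n × IsCycle w × n ≡ g) ×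
  (∀ n (w : Walk G n) → 1 ≤ n → IsCycle w → g ≤ n)

ClosedWalkLengths : ∀ {N} → Graph N → Fin N → Pred ℕ 0ℓ
ClosedWalkLengths G i n = 1 ≤ n × Σ (Walk G n) λ w → start w ≡ i × end w ≡ i

IsGcdOf : Pred ℕ 0ℓ → ℕ → Set
IsGcdOf P d = (∀ n → P n → d ∣ n) × (∀ e → (∀ n → P n → e ∣ n) → e ∣ d)

-- Take for A the closed-walk lengths at i that are at most 2N − 1.  A longer
-- closed walk at i repeats a vertex, v_a = v_b with a < b ≤ N, among its first
-- N + 1 vertices; cutting out v_a … v_b leaves a shorter closed walk at i, and
-- the gap b − a is the difference of the lengths a + q and b + q of two short
-- closed walks at i, which follow the walk to v_a (resp. v_b) and return to i
-- along the tail from v_b shortened below N.  So A and all closed-walk lengths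
-- have the same divisors.  A nonempty closed walk contains a cycle, hence has
-- length at least g, and a cycle has length at most N.
module Submission where

open import Defs
open import Data.Nat using (ℕ; zero; suc; _+_; _*_; _∸_; _≤_; _<_; z≤n; s≤s; _≤?_; _<?_; _≟_)
open import Data.Nat.Properties
open import Data.Nat.Divisibility using (_∣_; _∣0; ∣m∣n⇒∣m+n; ∣m+n∣m⇒∣n; ∣-trans)
open import Data.Nat.GCD using (gcd; gcd[m,n]∣m; gcd[m,n]∣n; gcd-greatest)
open import Data.Nat.Induction using (<-rec)
open import Data.Fin as Fin using (Fin; toℕ; inject₁; inject≤; fromℕ; fromℕ<)
open import Data.Fin.Properties
  using (toℕ<n; toℕ-fromℕ; toℕ-inject₁; toℕ-inject≤; toℕ-fromℕ<; any?; pigeonhole)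
  renaming (_≟_ to _≟ᶠ_)
open import Data.Product using (Σ; ∃; ∃₂; _×_; _,_; proj₁; proj₂)
open import Data.Sum using (inj₁; inj₂)
open import Data.Empty using (⊥-elim)
open import Function using (_∘_)
open import Relation.Nullary using (¬_; Dec; yes; no)
open import Relation.Nullary.Decidable using (T?; _×-dec_; ¬?; map′)
open import Relation.Unary using (Pred; Decidable; _⊆_)
open import Relation.Binary.PropositionalEquality
  using (_≡_; refl; sym; trans; cong; subst; subst₂; module ≡-Reasoning)
open import Level using (0ℓ)

+-∸-regroup : ∀ {a b} q → a ≤ b → b + q ≡ (a + q) + (b ∸ a)
+-∸-regroup {a} {b} q a≤b = begin
  b + q             ≡⟨ cong (_+ q) (m+[n∸m]≡n a≤b) ⟨
  a + (b ∸ a) + q   ≡⟨ +-assoc a (b ∸ a) q ⟩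
  a + (b ∸ a + q)   ≡⟨ cong (a +_) (+-comm (b ∸ a) q) ⟩
  a + (q + (b ∸ a)) ≡⟨ +-assoc a q (b ∸ a) ⟨
  a + q + (b ∸ a)   ∎
  where open ≡-Reasoning

m≤o∧n<o⇒m+n≤2*o∸1 : ∀ {m n o} → m ≤ o → n < o → m + n ≤ 2 * o ∸ 1
m≤o∧n<o⇒m+n≤2*o∸1 {m} {n} {o} m≤o n<o =
  <⇒≤pred (subst (m + n <_) (cong (o +_) (sym (+-identityʳ o))) (+-mono-≤-< m≤o n<o))

n≤2*n∸1 : ∀ {n} → Fin n → n ≤ 2 * n ∸ 1
n≤2*n∸1 {n} i =
  subst (_≤ 2 * n ∸ 1) (+-identityʳ n) (m≤o∧n<o⇒m+n≤2*o∸1 ≤-refl (≤-<-trans z≤n (toℕ<n i)))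

m<n≤o⇒m+[o∸n]<o : ∀ {m n o} → m < n → n ≤ o → m + (o ∸ n) < o
m<n≤o⇒m+[o∸n]<o {m} {n} {o} m<n n≤o = subst (m + (o ∸ n) <_) (m+[n∸m]≡n n≤o) (+-monoˡ-< (o ∸ n) m<n)

proper-gap< : ∀ {m n o} → m < n → n ≤ o → ¬ (m ≡ 0 × n ≡ o) → n ∸ m < o
proper-gap< {zero}  _   n≤o whole = ≤∧≢⇒< n≤o (λ n≡o → whole (refl , n≡o))
proper-gap< {suc m} m<n n≤o _     = <-≤-trans (∸-monoʳ-< (s≤s z≤n) (<⇒≤ m<n)) n≤o

pigeonhole-prefix : ∀ {N} (h : ℕ → Fin N) → ∃₂ λ a b → a < b × b ≤ N × h a ≡ h b
pigeonhole-prefix {N} h with a , b , a<b , same ← pigeonhole (n<1+n N) (h ∘ toℕ) =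
  toℕ a , toℕ b , a<b , ≤-pred (toℕ<n b) , same

-- The entry 0 is never consulted: every number divides 0.
module _ {P : Pred ℕ 0ℓ} (P? : Decidable P) where

  gcdUpTo : ℕ → ℕ
  gcdUpTo zero = 0
  gcdUpTo (suc k) with P? (suc k)
  ... | yes _ = gcd (suc k) (gcdUpTo k)
  ... | no  _ = gcdUpTo k

  gcdUpTo∣ : ∀ k n → n ≤ k → P n → gcdUpTo k ∣ n
  gcdUpTo∣ zero    n n≤0  _  = subst (0 ∣_) (sym (n≤0⇒n≡0 n≤0)) (0 ∣0)
  gcdUpTo∣ (suc k) n n≤1+k Pn with P? (suc k) | m≤n⇒m<n∨m≡n n≤1+k
  ... | yes _    | inj₂ refl = gcd[m,n]∣m (suc k) (gcdUpTo k)
  ... | yes _    | inj₁ n≤k = ∣-trans (gcd[m,n]∣n (suc k) (gcdUpTo k)) (gcdUpTo∣ k n (≤-pred n≤k) Pn)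
  ... | no ¬P1+k | inj₂ refl = ⊥-elim (¬P1+k Pn)
  ... | no _     | inj₁ n≤k = gcdUpTo∣ k n (≤-pred n≤k) Pn

  gcdUpTo-greatest : ∀ e k → (∀ n → n ≤ k → P n → e ∣ n) → e ∣ gcdUpTo k
  gcdUpTo-greatest e zero    _  = e ∣0
  gcdUpTo-greatest e (suc k) e∣ with P? (suc k)
  ... | yes P1+k =
    gcd-greatest (e∣ (suc k) ≤-refl P1+k) (gcdUpTo-greatest e k (λ n → e∣ n ∘ m≤n⇒m≤1+n))
  ... | no  _    = gcdUpTo-greatest e k (λ n → e∣ n ∘ m≤n⇒m≤1+n)

  gcdUpTo-isGcd : ∀ k → IsGcdOf (λ n → P n × n ≤ k) (gcdUpTo k)
  gcdUpTo-isGcd k = (λ n (Pn , n≤k) → gcdUpTo∣ k n n≤k Pn)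
                  , (λ e e∣ → gcdUpTo-greatest e k (λ n n≤k Pn → e∣ n (Pn , n≤k)))

clamp : (n k : ℕ) → Fin (suc n)
clamp n       zero    = Fin.zero
clamp zero    (suc k) = Fin.zero
clamp (suc n) (suc k) = Fin.suc (clamp n k)

clamp-toℕ : ∀ {n k} (j : Fin (suc n)) → toℕ j ≡ k → clamp n k ≡ j
clamp-toℕ Fin.zero refl = refl
clamp-toℕ {suc n} (Fin.suc j) refl = cong Fin.suc (clamp-toℕ j refl)

module Walks {N : ℕ} (G : Graph N) where

  -- A walk as a vertex sequence indexed by all of ℕ, of which only the
  -- first n + 1 entries matter: segments and concatenation become index
  -- arithmetic on ℕ instead of casts between Fin types.
  record SeqWalk (n : ℕ) : Set where
    field
      vertex : ℕ → Fin N
      edge   : ∀ k → k < n → Edge G (vertex k) (vertex (suc k))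
  open SeqWalk public

  _⇝[_]_ : Fin N → ℕ → Fin N → Set
  x ⇝[ n ] y = Σ (SeqWalk n) λ w → vertex w 0 ≡ x × vertex w n ≡ y

  vertices : ∀ {x y n} → x ⇝[ n ] y → ℕ → Fin N
  vertices = vertex ∘ proj₁

  WalkBetween : Fin N → Fin N → ℕ → Set
  WalkBetween x y n = Σ (Walk G n) λ w → start w ≡ x × end w ≡ y

  toWalk : ∀ {n} → SeqWalk n → Walk G n
  toWalk w = record
    { vtx  = vertex w ∘ toℕ
    ; step = λ k → subst (λ t → Edge G (vertex w t) (vertex w (suc (toℕ k))))
                         (sym (toℕ-inject₁ k)) (edge w (toℕ k) (toℕ<n k))
    }

  toWalk-end : ∀ {n} (w : SeqWalk n) → end (toWalk w) ≡ vertex w n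
  toWalk-end {n} w = cong (vertex w) (toℕ-fromℕ n)

  fromWalk : ∀ {n} (w : Walk G n) → start w ⇝[ n ] end w
  fromWalk {n} w = record { vertex = vtx w ∘ clamp n ; edge = edge′ }
                 , refl , cong (vtx w) (clamp-toℕ (fromℕ n) (toℕ-fromℕ n))
    where
    edge′ : ∀ k → k < n → Edge G (vtx w (clamp n k)) (vtx w (clamp n (suc k)))
    edge′ k k<n = subst₂ (λ s t → Edge G (vtx w s) (vtx w t))
      (sym (clamp-toℕ (inject₁ j) (trans (toℕ-inject₁ j) (toℕ-fromℕ< k<n))))
      (sym (clamp-toℕ (Fin.suc j) (cong suc (toℕ-fromℕ< k<n))))
      (step w j)
      where j = fromℕ< k<n

  toWalkBetween : ∀ {x y n} → x ⇝[ n ] y → WalkBetween x y n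
  toWalkBetween (w , refl , refl) = toWalk w , refl , toWalk-end w

  fromWalkBetween : ∀ {x y n} → WalkBetween x y n → x ⇝[ n ] y
  fromWalkBetween (w , refl , refl) = fromWalk w

  _∷_ : ∀ {x y z n} → Edge G x y → y ⇝[ n ] z → x ⇝[ suc n ] z
  _∷_ {x} x→y (w , refl , refl) = record { vertex = vertex′ ; edge = edge′ } , refl , refl
    where
    vertex′ : ℕ → Fin N
    vertex′ zero    = x
    vertex′ (suc k) = vertex w k
    edge′ : ∀ k → k < suc _ → Edge G (vertex′ k) (vertex′ (suc k))
    edge′ zero    _         = x→y
    edge′ (suc k) (s≤s k<n) = edge w k k<n

  uncons : ∀ {x z n} → x ⇝[ suc n ] z → ∃ λ y → Edge G x y × y ⇝[ n ] z
  uncons (w , refl , refl) =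
    vertex w 1 , edge w 0 (s≤s z≤n) ,
    record { vertex = vertex w ∘ suc ; edge = λ k k<n → edge w (suc k) (s≤s k<n) } , refl , refl

  _++_ : ∀ {x y z m n} → x ⇝[ m ] y → y ⇝[ n ] z → x ⇝[ m + n ] z
  _++_ {m = zero}  (w , refl , refl) q = q
  _++_ {m = suc m} p q with _ , x→y , p′ ← uncons p = x→y ∷ (p′ ++ q)

  segment : ∀ {a b n} (w : SeqWalk n) → a ≤ b → b ≤ n → vertex w a ⇝[ b ∸ a ] vertex w b
  segment {a} {b} w a≤b b≤n =
    record { vertex = vertex w ∘ (a +_) ; edge = edge′ } ,
    cong (vertex w) (+-identityʳ a) , cong (vertex w) (m+[n∸m]≡n a≤b)
    where
    edge′ : ∀ k → k < b ∸ a → Edge G (vertex w (a + k)) (vertex w (a + suc k))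
    edge′ k k<b∸a = subst (Edge G (vertex w (a + k)) ∘ vertex w) (sym (+-suc a k))
      (edge w (a + k) (<-≤-trans (subst (a + k <_) (m+[n∸m]≡n a≤b) (+-monoʳ-< a k<b∸a)) b≤n))

  prefix : ∀ {x y n a} (p : x ⇝[ n ] y) → a ≤ n → x ⇝[ a ] vertices p a
  prefix (w , refl , refl) a≤n = segment w z≤n a≤n

  suffix : ∀ {x y n b} (p : x ⇝[ n ] y) → b ≤ n → vertices p b ⇝[ n ∸ b ] y
  suffix (w , refl , refl) b≤n = segment w b≤n ≤-refl

  cut : ∀ {x y n a b} (p : x ⇝[ n ] y) → a < b → b ≤ n → vertices p a ≡ vertices p b →
        x ⇝[ a + (n ∸ b) ] y
  cut p a<b b≤n same =
    prefix p (≤-trans (<⇒≤ a<b) b≤n) ++ subst (_⇝[ _ ] _) (sym same) (suffix p b≤n)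

  shorten : ∀ {x y n} → x ⇝[ n ] y → ∃ λ m → m < N × x ⇝[ m ] y
  shorten {x} {y} {n} = <-rec (λ n → x ⇝[ n ] y → ∃ λ m → m < N × x ⇝[ m ] y) go n
    where
    go : ∀ n → (∀ {m} → m < n → x ⇝[ m ] y → ∃ λ k → k < N × x ⇝[ k ] y) →
         x ⇝[ n ] y → ∃ λ m → m < N × x ⇝[ m ] y
    go n rec p with n <? N
    ... | yes n<N = n , n<N , p
    ... | no  n≮N = shortcut (pigeonhole-prefix (vertices p))
      where
      shortcut : (∃₂ λ a b → a < b × b ≤ N × vertices p a ≡ vertices p b) →
                 ∃ λ m → m < N × x ⇝[ m ] y
      shortcut (a , b , a<b , b≤N , same) = rec (m<n≤o⇒m+[o∸n]<o a<b b≤n) (cut p a<b b≤n same)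
        where b≤n = ≤-trans b≤N (≮⇒≥ n≮N)

  walk? : ∀ n x y → Dec (x ⇝[ n ] y)
  walk? zero x y with x ≟ᶠ y
  ... | yes refl = yes (record { vertex = λ _ → x ; edge = λ _ () } , refl , refl)
  ... | no  x≢y  = no λ (_ , start≡ , end≡) → x≢y (trans (sym start≡) end≡)
  walk? (suc n) x y with any? (λ z → T? (G x z) ×-dec walk? n z y)
  ... | yes (_ , x→z , q) = yes (x→z ∷ q)
  ... | no  none          = no λ p → let z , x→z , q = uncons p in none (z , x→z , q)

  closedWalkLengths? : ∀ i → Decidable (ClosedWalkLengths G i)
  closedWalkLengths? i n = (1 ≤? n) ×-dec map′ toWalkBetween fromWalkBetween (walk? n i i)

  closed⇒cycle : ∀ {n} (w : SeqWalk n) → 1 ≤ n → vertex w 0 ≡ vertex w n →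
                 ∃ λ m → 1 ≤ m × m ≤ n × Σ (Walk G m) IsCycle
  closed⇒cycle {n} = <-rec Goal go n
    where
    Goal : ℕ → Set
    Goal n = (w : SeqWalk n) → 1 ≤ n → vertex w 0 ≡ vertex w n →
             ∃ λ m → 1 ≤ m × m ≤ n × Σ (Walk G m) IsCycle
    go : ∀ n → (∀ {m} → m < n → Goal m) → Goal n
    go n rec w 1≤n closed
      with any? (λ (a : Fin (suc n)) → any? (λ (b : Fin (suc n)) →
             (toℕ a <? toℕ b) ×-dec (vertex w (toℕ a) ≟ᶠ vertex w (toℕ b))
               ×-dec ¬? ((toℕ a ≟ 0) ×-dec (toℕ b ≟ n))))
    ... | yes (a , b , a<b , same , proper) =
      let m , 1≤m , m≤gap , cycle = rec shorter w′ (m<n⇒0<n∸m a<b) closed′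
      in m , 1≤m , ≤-trans m≤gap (<⇒≤ shorter) , cycle
      where
      b≤n = ≤-pred (toℕ<n b)
      shorter = proper-gap< a<b b≤n proper
      gap = segment w (<⇒≤ a<b) b≤n
      w′ = proj₁ gap
      closed′ = trans (proj₁ (proj₂ gap)) (trans same (sym (proj₂ (proj₂ gap))))
    ... | no none = n , 1≤n , ≤-refl , toWalk w ,
                    trans closed (sym (toWalk-end w)) , simple
      where
      simple : ∀ (a b : Fin (suc n)) → toℕ a < toℕ b → vertex w (toℕ a) ≡ vertex w (toℕ b) →
               toℕ a ≡ 0 × toℕ b ≡ n
      simple a b a<b same with (toℕ a ≟ 0) ×-dec (toℕ b ≟ n)
      ... | yes whole  = whole
      ... | no  proper = ⊥-elim (none (a , b , a<b , same , proper))

  girth≤closedWalkLength : ∀ {g} → (∀ n (w : Walk G n) → 1 ≤ n → IsCycle w → g ≤ n) →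
                           ∀ {i n} → ClosedWalkLengths G i n → g ≤ n
  girth≤closedWalkLength girth-min (1≤n , walk) with w , start≡ , end≡ ← fromWalkBetween walk
    with m , 1≤m , m≤n , c , cycle ← closed⇒cycle w 1≤n (trans start≡ (sym end≡))
    = ≤-trans (girth-min m c 1≤m cycle) m≤n

  cycle-length≤N : ∀ {n} (w : Walk G n) → IsCycle w → n ≤ N
  cycle-length≤N {n} w (_ , simple) with n ≤? N
  ... | yes n≤N = n≤N
  ... | no  n≰N = ⊥-elim (repetition (pigeonhole (n<1+n N) (vtx w ∘ embed)))
    where
    N<n = ≰⇒> n≰N
    embed : Fin (suc N) → Fin (suc n)
    embed j = inject≤ j (s≤s (<⇒≤ N<n))
    repetition : ¬ (∃₂ λ a b → a Fin.< b × vtx w (embed a) ≡ vtx w (embed b))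
    repetition (a , b , a<b , same) = <⇒≢ (≤-<-trans (≤-pred (toℕ<n b)) N<n) b≡n
      where
      b≡n : toℕ b ≡ n
      b≡n = trans (sym (toℕ-inject≤ b _))
        (proj₂ (simple _ _ (subst₂ _<_ (sym (toℕ-inject≤ a _)) (sym (toℕ-inject≤ b _)) a<b) same))

  ∣repetition-gap : ∀ {e i n a b} →
    (∀ {m} → m ≤ 2 * N ∸ 1 → i ⇝[ m ] i → e ∣ m) →
    (p : i ⇝[ n ] i) → a < b → b ≤ N → b ≤ n → vertices p a ≡ vertices p b → e ∣ b ∸ a
  ∣repetition-gap {e} {i} {a = a} {b} ∣short p a<b b≤N b≤n same = return (shorten (suffix p b≤n))
    where
    return : (∃ λ q → q < N × vertices p b ⇝[ q ] i) → e ∣ b ∸ a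
    return (q , q<N , back) =
      ∣m+n∣m⇒∣n (subst (e ∣_) (+-∸-regroup q (<⇒≤ a<b)) (∣short (m≤o∧n<o⇒m+n≤2*o∸1 b≤N q<N) viaB))
                (∣short (m≤o∧n<o⇒m+n≤2*o∸1 (≤-trans (<⇒≤ a<b) b≤N) q<N) viaA)
      where
      viaB = prefix p b≤n ++ back
      viaA = prefix p (≤-trans (<⇒≤ a<b) b≤n) ++ subst (_⇝[ q ] i) (sym same) back

  ∣short-closed⇒∣closed : ∀ {e i} → (∀ {m} → m ≤ 2 * N ∸ 1 → i ⇝[ m ] i → e ∣ m) →
                          ∀ n → i ⇝[ n ] i → e ∣ n
  ∣short-closed⇒∣closed {e} {i} ∣short = <-rec (λ n → i ⇝[ n ] i → e ∣ n) go
    where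
    go : ∀ n → (∀ {m} → m < n → i ⇝[ m ] i → e ∣ m) → i ⇝[ n ] i → e ∣ n
    go n rec p with n ≤? 2 * N ∸ 1
    ... | yes short = ∣short short p
    ... | no  long = split (pigeonhole-prefix (vertices p))
      where
      split : (∃₂ λ a b → a < b × b ≤ N × vertices p a ≡ vertices p b) → e ∣ n
      split (a , b , a<b , b≤N , same) =
        subst (e ∣_) (sym (trans (sym (m+[n∸m]≡n b≤n)) (+-∸-regroup (n ∸ b) (<⇒≤ a<b))))
          (∣m∣n⇒∣m+n (rec (m<n≤o⇒m+[o∸n]<o a<b b≤n) (cut p a<b b≤n same))
                     (∣repetition-gap ∣short p a<b b≤N b≤n same))
        where b≤n = ≤-trans b≤N (≤-trans (n≤2*n∸1 i) (<⇒≤ (≰⇒> long)))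

lemma4 : (N : ℕ) (G : Graph N) (g : ℕ) → StronglyConnected G → IsGirth G g →
    (i : Fin N) → Σ (Pred ℕ 0ℓ) λ A →
      (A ⊆ ClosedWalkLengths G i) ×
      (Σ ℕ λ d → IsGcdOf A d × IsGcdOf (ClosedWalkLengths G i) d) ×
      (∀ n (w : Walk G n) → 1 ≤ n → IsCycle w → start w ≡ i → A n) ×
      (∀ n → A n → g ≤ n × n ≤ 2 * N ∸ 1)
lemma4 N G g _ (_ , girth-min) i =
  A , proj₁ , (d , gcdUpTo-isGcd closed? B , ∣closed , greatest) , cycle∈A ,
  λ n (closed , n≤B) → girth≤closedWalkLength girth-min closed , n≤B
  where
  open Walks G
  B = 2 * N ∸ 1
  closed? = closedWalkLengths? i
  A : Pred ℕ 0ℓ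
  A n = ClosedWalkLengths G i n × n ≤ B
  d = gcdUpTo closed? B

  ∣short : ∀ {m} → m ≤ B → i ⇝[ m ] i → d ∣ m
  ∣short {zero}  _   _ = d ∣0
  ∣short {suc m} m≤B p = proj₁ (gcdUpTo-isGcd closed? B) (suc m) ((s≤s z≤n , toWalkBetween p) , m≤B)

  ∣closed : ∀ n → ClosedWalkLengths G i n → d ∣ n
  ∣closed n (_ , walk) = ∣short-closed⇒∣closed ∣short n (fromWalkBetween walk)

  greatest : ∀ e → (∀ n → ClosedWalkLengths G i n → e ∣ n) → e ∣ d
  greatest e e∣ = proj₂ (gcdUpTo-isGcd closed? B) e (λ n → e∣ n ∘ proj₁)

  cycle∈A : ∀ n (w : Walk G n) → 1 ≤ n → IsCycle w → start w ≡ i → A n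
  cycle∈A n w 1≤n cycle start≡i =
    (1≤n , w , start≡i , trans (sym (proj₁ cycle)) start≡i) ,
    ≤-trans (cycle-length≤N w cycle) (n≤2*n∸1 i)
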